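{- For all $m\ge1$, $\varphi(x_m)=f_e$ and $\varphi(y_m)=f_s$, where $f_e$ (resp. $f_s$) is the constant function on $\mathcal{C}_m$ with value $e$ (resp. $s$).
   Context: Let $[n]=\{0,\dots,n-1\}$, $S_n$ the bijections of $[n]$. Identify $\mathbb{F}_2^m$ with $[2^m]$ via $(a_0,\dots,a_{m-1})\mapsto\sum_i a_i2^{m-1-i}$. A basic $k$-interval ($0\le k\le m$) is $\{c2^k,\dots,(c+1)2^k-1\}\subseteq[2^m]$. $\pi\in S_{2^m}$ is dyadically well-distributed if for every basic $k_1$-interval $S$ and basic $k_2$-interval $T$ with $k_1+k_2=m$ there is exactly one $i\in S$ with $\pi(i)\in T$; $\mathrm{DWD}_m$ is the set of these. Define $x_1=(0,1)$ (one-line notation) and $x_{m+1}=(x_m(0),x_m(0)+2^m,x_m(1),x_m(1)+2^m,\dots,x_m(2^m-1),x_m(2^m-1)+2^m)$; $y_m$ is the reversal of $x_m$ in one-line notation. Both $x_m,y_m$ lie in $\mathrm{DWD}_m$. A complementary pair is $(S,T)$ with $S$ a basic $k_1$-interval, $T$ a basic $k_2$-interval, $k_1+k_2=m+1$, $k_1,k_2\ge1$; $\mathcal{C}_m$ is the set of these. For $\pi\in\mathrm{DWD}_m$ and $(S,T)\in\mathcal{C}_m$ there are exactly two $a<b$ in $S$ with $\pi(a),\pi(b)\in T$; $\varphi(\pi)(S,T)=e$ if $\pi(a)<\pi(b)$ and $s$ otherwise. -}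

module Defs where

open import Data.Nat using (ℕ; zero; suc; _+_; _*_; _∸_; _^_; _≤_; _<_; _<ᵇ_; _≤ᵇ_)
open import Data.Bool using (Bool; true; false; _∧_; if_then_else_)
open import Data.List using (List; []; _∷_; concatMap; reverse; filterᵇ; map; upTo)
open import Data.Maybe using (Maybe; just; nothing)
open import Data.Product using (_×_; _,_)
open import Relation.Binary.PropositionalEquality using (_≡_)

-- One-line notation: a permutation of [n] is the list (π(0), …, π(n-1)).
-- π(i) = i-th entry (default 0 outside the range; never used there).
at : List ℕ → ℕ → ℕ
at []       _       = 0
at (v ∷ _)  zero    = v
at (_ ∷ vs) (suc i) = at vs i

-- x_1 = (0,1);  x_{m+1} = (x_m(0), x_m(0)+2^m, x_m(1), x_m(1)+2^m, …)
-- (x 0 is irrelevant; the statement only uses m ≥ 1)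
x : ℕ → List ℕ
x zero                = []
x (suc zero)          = 0 ∷ 1 ∷ []
x (suc m@(suc _))     = concatMap (λ v → v ∷ (v + 2 ^ m) ∷ []) (x m)

y : ℕ → List ℕ
y m = reverse (x m)

-- The basic k-interval with index c:  {c 2^k, …, (c+1) 2^k - 1}
-- membership test and its elements in increasing order
inIntervalᵇ : ℕ → ℕ → ℕ → Bool
inIntervalᵇ k c v = (c * 2 ^ k ≤ᵇ v) ∧ (v <ᵇ suc c * 2 ^ k)

intervalElems : ℕ → ℕ → List ℕ
intervalElems k c = map (λ j → c * 2 ^ k + j) (upTo (2 ^ k))

IsBasicInterval : ℕ → ℕ × ℕ → Set
IsBasicInterval m (k , c) = k ≤ m × c < 2 ^ (m ∸ k)

IsComplementaryPair : ℕ → ℕ × ℕ → ℕ × ℕ → Set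
IsComplementaryPair m (k₁ , c₁) (k₂ , c₂) =
  IsBasicInterval m (k₁ , c₁) × IsBasicInterval m (k₂ , c₂) ×
  1 ≤ k₁ × 1 ≤ k₂ × k₁ + k₂ ≡ suc m

data Sym : Set where
  e s : Sym

-- φ(π)(S,T): let a < b be the (exactly two) elements of S with π(a), π(b) ∈ T;
-- value e if π(a) < π(b), s otherwise.  If the hit set does not have exactly
-- two elements (impossible for π ∈ DWD_m) the value is undefined (nothing).
φ : List ℕ → ℕ × ℕ → ℕ × ℕ → Maybe Sym
φ π (k₁ , c₁) (k₂ , c₂) with filterᵇ (λ i → inIntervalᵇ k₂ c₂ (at π i)) (intervalElems k₁ c₁)
... | a ∷ b ∷ [] = just (if at π a <ᵇ at π b then e else s)
... | _          = nothing

module Submission where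

-- x_m is the bit-reversal permutation of [2^m] and y_m, which reads x_m backwards, is bit
-- reversal followed by complementing every bit (reverseBits false m and reverseBits true m).
-- For m = r + q + 1, a basic (r+1)-interval S with index c₁ is the union of the basic
-- r-intervals with indices t + 2c₁ (t = 0, 1); bit reversal sends offset l in the t-th half to
-- rev_r(l)·2^(q+1) + rev_(q+1)(t + 2c₁), which lies in the basic (q+1)-interval T with index c₂
-- exactly when rev_r(l) = c₂. So each half contributes exactly one point with image in T, and
-- the two images differ only in bit q, which is t for x_m and 1 − t for y_m.

open import Defs
open import Data.Bool using (Bool; true; false; not; T; if_then_else_)
open import Data.Bool.Properties using (T-∧)
open import Data.List using (List; []; _∷_; _++_; _∷ʳ_; length; reverse; concatMap; applyUpTo; filterᵇ)
open import Data.List.Properties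
  using (map-upTo; filter-++; filter-accept; filter-reject; unfold-reverse; length-reverse)
open import Data.Maybe using (just)
open import Data.Nat
open import Data.Nat.DivMod
open import Data.Nat.Properties
open import Data.Nat.Tactic.RingSolver using (solve-∀)
open import Data.Product using (_×_; _,_)
open import Data.Sum using (inj₁; inj₂)
open import Function using (_∘_; _⇔_; mk⇔; Equivalence)
open import Relation.Binary.PropositionalEquality
open import Relation.Nullary using (¬_)
open import Relation.Nullary.Decidable using (T?)
open import Relation.Nullary.Reflects using (det; ofʸ; ofⁿ)

m*o+n<p*o : ∀ {m n o p} → m < p → n < o → m * o + n < p * o
m*o+n<p*o {m} {n} {o} {p} m<p n<o = begin-strict
  m * o + n  <⟨ +-monoʳ-< (m * o) n<o ⟩
  m * o + o  ≡⟨ +-comm (m * o) o ⟩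
  suc m * o  ≤⟨ *-monoˡ-≤ o m<p ⟩
  p * o      ∎
  where open ≤-Reasoning

bit-%2 : ∀ {t} c → t < 2 → (t + c * 2) % 2 ≡ t
bit-%2 {t} c t<2 = trans ([m+kn]%n≡m%n t c 2) (m<n⇒m%n≡m t<2)

bit-/2 : ∀ {t} c → t < 2 → (t + c * 2) / 2 ≡ c
bit-/2 {t} c t<2 = begin
  (t + c * 2) / 2          ≡⟨ +-distrib-/ t (c * 2) no-carry ⟩
  t / 2 + c * 2 / 2        ≡⟨ cong₂ _+_ (m<n⇒m/n≡0 t<2) (m*n/n≡m c 2) ⟩
  c                        ∎
  where
  open ≡-Reasoning
  no-carry : t % 2 + c * 2 % 2 < 2
  no-carry = subst (_< 2) (sym (trans (cong₂ _+_ (m<n⇒m%n≡m t<2) (m*n%n≡0 c 2)) (+-identityʳ t))) t<2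

half-< : ∀ p {i} → i < 2 ^ suc p → i / 2 < 2 ^ p
half-< p {i} i< = m<n*o⇒m/o<n (subst (i <_) (*-comm 2 (2 ^ p)) i<)

flipBit : Bool → ℕ → ℕ
flipBit false b = b
flipBit true  b = 1 ∸ b

flipBit-< : ∀ f {b} → b < 2 → flipBit f b < 2
flipBit-< false b<2 = b<2
flipBit-< true  {b} _ = s≤s (m∸n≤m 1 b)

flipBit-involutive : ∀ f {b} → b < 2 → flipBit f (flipBit f b) ≡ b
flipBit-involutive false _ = refl
flipBit-involutive true  {0} _ = refl
flipBit-involutive true  {1} _ = refl
flipBit-involutive true  {2+ _} (s≤s (s≤s ()))

flipBit-complement : ∀ f {b} → b < 2 → flipBit f (1 ∸ b) ≡ flipBit (not f) b
flipBit-complement false {0} _ = refl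
flipBit-complement false {1} _ = refl
flipBit-complement true  {0} _ = refl
flipBit-complement true  {1} _ = refl
flipBit-complement f     {2+ _} (s≤s (s≤s ()))

reverseBits : Bool → ℕ → ℕ → ℕ
reverseBits f zero    i = 0
reverseBits f (suc p) i = flipBit f (i % 2) * 2 ^ p + reverseBits f p (i / 2)

reverseBits-< : ∀ f p i → reverseBits f p i < 2 ^ p
reverseBits-< f zero    i = s≤s z≤n
reverseBits-< f (suc p) i =
  m*o+n<p*o (flipBit-< f (m%n<n i 2)) (reverseBits-< f p (i / 2))

reverseBits-bit : ∀ f p {t} c → t < 2 →
  reverseBits f (suc p) (t + c * 2) ≡ flipBit f t * 2 ^ p + reverseBits f p c
reverseBits-bit f p c t<2 =
  cong₂ (λ t′ c′ → flipBit f t′ * 2 ^ p + reverseBits f p c′) (bit-%2 c t<2) (bit-/2 c t<2)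

reverseBits-split : ∀ f p k h {l} → l < 2 ^ p →
  reverseBits f (p + k) (h * 2 ^ p + l) ≡ reverseBits f p l * 2 ^ k + reverseBits f k h
reverseBits-split f zero k h {0} _ = cong (reverseBits f k) (trans (+-identityʳ _) (*-identityʳ h))
reverseBits-split f zero k h {suc _} (s≤s ())
reverseBits-split f (suc p) k h {l} l< = begin
  reverseBits f (suc p + k) (h * 2 ^ suc p + l)
    ≡⟨ cong (reverseBits f (suc p + k)) regroup ⟩
  reverseBits f (suc p + k) (l % 2 + (h * 2 ^ p + l / 2) * 2)
    ≡⟨ reverseBits-bit f (p + k) (h * 2 ^ p + l / 2) (m%n<n l 2) ⟩
  b * 2 ^ (p + k) + reverseBits f (p + k) (h * 2 ^ p + l / 2)
    ≡⟨ cong₂ _+_ (cong (b *_) (^-distribˡ-+-* 2 p k)) (reverseBits-split f p k h (half-< p l<)) ⟩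
  b * (2 ^ p * 2 ^ k) + (reverseBits f p (l / 2) * 2 ^ k + reverseBits f k h)
    ≡⟨ distribute b (2 ^ p) (2 ^ k) (reverseBits f p (l / 2)) (reverseBits f k h) ⟩
  reverseBits f (suc p) l * 2 ^ k + reverseBits f k h
    ∎
  where
  open ≡-Reasoning
  b = flipBit f (l % 2)
  regroup : h * 2 ^ suc p + l ≡ l % 2 + (h * 2 ^ p + l / 2) * 2
  regroup = trans (cong (h * 2 ^ suc p +_) (m≡m%n+[m/n]*n l 2)) (identity h (2 ^ p) (l % 2) (l / 2))
    where
    identity : ∀ h n t c → h * (2 * n) + (t + c * 2) ≡ t + (h * n + c) * 2
    identity = solve-∀
  distribute : ∀ b n m a d → b * (n * m) + (a * m + d) ≡ (b * n + a) * m + d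
  distribute = solve-∀

reverseBits-one : ∀ f {b} → b < 2 → reverseBits f 1 b ≡ flipBit f b
reverseBits-one false {0} _ = refl
reverseBits-one false {1} _ = refl
reverseBits-one true  {0} _ = refl
reverseBits-one true  {1} _ = refl
reverseBits-one f     {2+ _} (s≤s (s≤s ()))

reverseBits-involutive : ∀ f p {i} → i < 2 ^ p → reverseBits f p (reverseBits f p i) ≡ i
reverseBits-involutive f zero    {0} _ = refl
reverseBits-involutive f zero    {suc _} (s≤s ())
reverseBits-involutive f (suc p) {i} i< = begin
  reverseBits f (suc p) (b * 2 ^ p + reverseBits f p (i / 2))
    ≡⟨ cong (λ n → reverseBits f n (b * 2 ^ p + reverseBits f p (i / 2))) (+-comm 1 p) ⟩
  reverseBits f (p + 1) (b * 2 ^ p + reverseBits f p (i / 2))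
    ≡⟨ reverseBits-split f p 1 b (reverseBits-< f p (i / 2)) ⟩
  reverseBits f p (reverseBits f p (i / 2)) * 2 + reverseBits f 1 b
    ≡⟨ cong₂ (λ c t → c * 2 + t) (reverseBits-involutive f p (half-< p i<)) (reverseBits-one f (flipBit-< f (m%n<n i 2))) ⟩
  i / 2 * 2 + flipBit f b
    ≡⟨ cong (i / 2 * 2 +_) (flipBit-involutive f (m%n<n i 2)) ⟩
  i / 2 * 2 + i % 2
    ≡⟨ trans (+-comm (i / 2 * 2) (i % 2)) (sym (m≡m%n+[m/n]*n i 2)) ⟩
  i ∎
  where
  open ≡-Reasoning
  b = flipBit f (i % 2)

complement-bits : ∀ p {t c} → t < 2 → c < 2 ^ p →
  2 ^ suc p ∸ suc (t + c * 2) ≡ (1 ∸ t) + (2 ^ p ∸ suc c) * 2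
complement-bits p {t} {c} t<2 c< = begin
  2 ^ suc p ∸ suc (t + c * 2)
    ≡⟨ cong (_∸ suc (t + c * 2)) (sym total) ⟩
  suc (t + c * 2) + ((1 ∸ t) + d * 2) ∸ suc (t + c * 2)
    ≡⟨ m+n∸m≡n (suc (t + c * 2)) _ ⟩
  (1 ∸ t) + d * 2 ∎
  where
  open ≡-Reasoning
  d = 2 ^ p ∸ suc c
  twice : ∀ {t} → t < 2 → suc (t + c * 2) + ((1 ∸ t) + d * 2) ≡ (suc c + d) + ((suc c + d) + 0)
  twice {0} _ = identity c d
    where
    identity : ∀ c d → suc (c * 2) + suc (d * 2) ≡ (suc c + d) + ((suc c + d) + 0)
    identity = solve-∀
  twice {1} _ = identity c d
    where
    identity : ∀ c d → suc (suc (c * 2)) + d * 2 ≡ (suc c + d) + ((suc c + d) + 0)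
    identity = solve-∀
  twice {2+ _} (s≤s (s≤s ()))
  total : suc (t + c * 2) + ((1 ∸ t) + d * 2) ≡ 2 ^ suc p
  total = trans (twice t<2) (cong (λ n → n + (n + 0)) (m+[n∸m]≡n c<))

reverseBits-complement : ∀ f p {i} → i < 2 ^ p →
  reverseBits f p (2 ^ p ∸ suc i) ≡ reverseBits (not f) p i
reverseBits-complement f zero    _  = refl
reverseBits-complement f (suc p) {i} i< = begin
  reverseBits f (suc p) (2 ^ suc p ∸ suc i)
    ≡⟨ cong (λ j → reverseBits f (suc p) (2 ^ suc p ∸ suc j)) (m≡m%n+[m/n]*n i 2) ⟩
  reverseBits f (suc p) (2 ^ suc p ∸ suc (i % 2 + i / 2 * 2))
    ≡⟨ cong (reverseBits f (suc p)) (complement-bits p (m%n<n i 2) (half-< p i<)) ⟩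
  reverseBits f (suc p) ((1 ∸ i % 2) + (2 ^ p ∸ suc (i / 2)) * 2)
    ≡⟨ reverseBits-bit f p _ (s≤s (m∸n≤m 1 (i % 2))) ⟩
  flipBit f (1 ∸ i % 2) * 2 ^ p + reverseBits f p (2 ^ p ∸ suc (i / 2))
    ≡⟨ cong₂ (λ b r → b * 2 ^ p + r) (flipBit-complement f (m%n<n i 2)) (reverseBits-complement f p (half-< p i<)) ⟩
  reverseBits (not f) (suc p) i ∎
  where
  open ≡-Reasoning

BitReversal : Bool → ℕ → List ℕ → Set
BitReversal f m π = ∀ {i} → i < 2 ^ m → at π i ≡ reverseBits f m i

length-interleave : ∀ K (l : List ℕ) → length (concatMap (λ v → v ∷ v + K ∷ []) l) ≡ length l * 2
length-interleave K []      = refl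
length-interleave K (v ∷ l) = cong (λ n → suc (suc n)) (length-interleave K l)

at-interleave : ∀ K (l : List ℕ) {t j} → t < 2 → j < length l →
  at (concatMap (λ v → v ∷ v + K ∷ []) l) (t + j * 2) ≡ at l j + t * K
at-interleave K (v ∷ l) {0}    {zero}  _ _ = sym (+-identityʳ v)
at-interleave K (v ∷ l) {1}    {zero}  _ _ = cong (v +_) (sym (+-identityʳ K))
at-interleave K (v ∷ l) {0}    {suc j} t<2 (s≤s j<) = at-interleave K l t<2 j<
at-interleave K (v ∷ l) {1}    {suc j} t<2 (s≤s j<) = at-interleave K l t<2 j<
at-interleave K (v ∷ l) {2+ _} (s≤s (s≤s ())) _

length-x : ∀ m → length (x (suc m)) ≡ 2 ^ suc m
length-x zero    = refl
length-x (suc m) = begin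
  length (x (suc (suc m)))       ≡⟨ length-interleave (2 ^ suc m) (x (suc m)) ⟩
  length (x (suc m)) * 2         ≡⟨ cong (_* 2) (length-x m) ⟩
  2 ^ suc m * 2                  ≡⟨ *-comm (2 ^ suc m) 2 ⟩
  2 ^ suc (suc m)                ∎
  where open ≡-Reasoning

at-x : ∀ m → BitReversal false m (x m)
at-x zero          {0}     _  = refl
at-x zero          {suc _} (s≤s ())
at-x (suc zero)    {0}     _  = refl
at-x (suc zero)    {1}     _  = refl
at-x (suc zero)    {2+ _}  (s≤s (s≤s ()))
at-x (suc (suc m)) {i}     i< = begin
  at (x (suc (suc m))) i
    ≡⟨ cong (at (x (suc (suc m)))) (m≡m%n+[m/n]*n i 2) ⟩
  at (x (suc (suc m))) (i % 2 + i / 2 * 2)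
    ≡⟨ at-interleave (2 ^ suc m) (x (suc m)) (m%n<n i 2) (subst (i / 2 <_) (sym (length-x m)) (half-< (suc m) i<)) ⟩
  at (x (suc m)) (i / 2) + i % 2 * 2 ^ suc m
    ≡⟨ cong (_+ i % 2 * 2 ^ suc m) (at-x (suc m) (half-< (suc m) i<)) ⟩
  reverseBits false (suc m) (i / 2) + i % 2 * 2 ^ suc m
    ≡⟨ +-comm (reverseBits false (suc m) (i / 2)) (i % 2 * 2 ^ suc m) ⟩
  reverseBits false (suc (suc m)) i ∎
  where open ≡-Reasoning

at-++ˡ : ∀ (l r : List ℕ) {i} → i < length l → at (l ++ r) i ≡ at l i
at-++ˡ (v ∷ l) r {zero}  _        = refl
at-++ˡ (v ∷ l) r {suc i} (s≤s i<) = at-++ˡ l r i<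

at-∷ʳ-length : ∀ (l : List ℕ) v → at (l ∷ʳ v) (length l) ≡ v
at-∷ʳ-length []      v = refl
at-∷ʳ-length (w ∷ l) v = at-∷ʳ-length l v

at-reverse : ∀ (l : List ℕ) {i} → i < length l → at (reverse l) i ≡ at l (length l ∸ suc i)
at-reverse (v ∷ l) {i} (s≤s i≤) rewrite unfold-reverse v l with m≤n⇒m<n∨m≡n i≤
... | inj₁ i<n = begin
  at (reverse l ∷ʳ v) i                    ≡⟨ at-++ˡ (reverse l) (v ∷ []) (subst (i <_) (sym (length-reverse l)) i<n) ⟩
  at (reverse l) i                         ≡⟨ at-reverse l i<n ⟩
  at l (length l ∸ suc i)                  ≡⟨ cong (at (v ∷ l)) (sym (+-∸-assoc 1 i<n)) ⟩
  at (v ∷ l) (length (v ∷ l) ∸ suc i)      ∎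
  where open ≡-Reasoning
... | inj₂ refl = begin
  at (reverse l ∷ʳ v) (length l)           ≡⟨ cong (at (reverse l ∷ʳ v)) (sym (length-reverse l)) ⟩
  at (reverse l ∷ʳ v) (length (reverse l)) ≡⟨ at-∷ʳ-length (reverse l) v ⟩
  v                                        ≡⟨ cong (at (v ∷ l)) (sym (n∸n≡0 (length l))) ⟩
  at (v ∷ l) (length l ∸ length l)         ∎
  where open ≡-Reasoning

at-y : ∀ m → BitReversal true m (y m)
at-y zero    {0}     _  = refl
at-y zero    {suc _} (s≤s ())
at-y (suc m) {i}     i< = begin
  at (reverse (x (suc m))) i
    ≡⟨ at-reverse (x (suc m)) (subst (i <_) (sym (length-x m)) i<) ⟩
  at (x (suc m)) (length (x (suc m)) ∸ suc i)
    ≡⟨ cong (λ n → at (x (suc m)) (n ∸ suc i)) (length-x m) ⟩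
  at (x (suc m)) (2 ^ suc m ∸ suc i)
    ≡⟨ at-x (suc m) (∸-monoʳ-< z<s i<) ⟩
  reverseBits false (suc m) (2 ^ suc m ∸ suc i)
    ≡⟨ reverseBits-complement false (suc m) i< ⟩
  reverseBits true (suc m) i ∎
  where open ≡-Reasoning

module _ {a} {A : Set a} (p : A → Bool) where

  filterᵇ-applyUpTo-none : ∀ (g : ℕ → A) n → (∀ {j} → j < n → ¬ T (p (g j))) →
    filterᵇ p (applyUpTo g n) ≡ []
  filterᵇ-applyUpTo-none g zero    _    = refl
  filterᵇ-applyUpTo-none g (suc n) miss =
    trans (filter-reject (T? ∘ p) (miss z<s)) (filterᵇ-applyUpTo-none (g ∘ suc) n (miss ∘ s<s))

  filterᵇ-applyUpTo-single : ∀ (g : ℕ → A) {n j₀} → j₀ < n → T (p (g j₀)) →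
    (∀ {j} → j < n → T (p (g j)) → j ≡ j₀) → filterᵇ p (applyUpTo g n) ≡ g j₀ ∷ []
  filterᵇ-applyUpTo-single g {suc n} {zero}   _         hit only =
    trans (filter-accept (T? ∘ p) hit)
          (cong (g 0 ∷_) (filterᵇ-applyUpTo-none (g ∘ suc) n (λ j< h → 0≢1+n (sym (only (s<s j<) h)))))
  filterᵇ-applyUpTo-single g {suc n} {suc j₀} (s≤s j₀<) hit only =
    trans (filter-reject (T? ∘ p) (λ h → 0≢1+n (only z<s h)))
          (filterᵇ-applyUpTo-single (g ∘ suc) j₀< hit (λ j< h → suc-injective (only (s<s j<) h)))

applyUpTo-+ : ∀ {a} {A : Set a} (g : ℕ → A) m n →
  applyUpTo g (m + n) ≡ applyUpTo g m ++ applyUpTo (g ∘ (m +_)) n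
applyUpTo-+ g zero    n = refl
applyUpTo-+ g (suc m) n = cong (g 0 ∷_) (applyUpTo-+ (g ∘ suc) m n)

applyUpTo-cong : ∀ {a} {A : Set a} {g h : ℕ → A} → (∀ j → g j ≡ h j) → ∀ n → applyUpTo g n ≡ applyUpTo h n
applyUpTo-cong g≗h zero    = refl
applyUpTo-cong g≗h (suc n) = cong₂ _∷_ (g≗h 0) (applyUpTo-cong (g≗h ∘ suc) n)

intervalElems-suc : ∀ k c → intervalElems (suc k) c ≡ intervalElems k (c * 2) ++ intervalElems k (1 + c * 2)
intervalElems-suc k c = begin
  intervalElems (suc k) c
    ≡⟨ map-upTo (c * 2 ^ suc k +_) (2 ^ suc k) ⟩
  applyUpTo (c * 2 ^ suc k +_) (2 ^ k + (2 ^ k + 0))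
    ≡⟨ applyUpTo-+ (c * 2 ^ suc k +_) (2 ^ k) (2 ^ k + 0) ⟩
  applyUpTo (c * 2 ^ suc k +_) (2 ^ k) ++ applyUpTo (λ j → c * 2 ^ suc k + (2 ^ k + j)) (2 ^ k + 0)
    ≡⟨ cong₂ _++_ (applyUpTo-cong (lower c (2 ^ k)) (2 ^ k))
                  (trans (cong (applyUpTo _) (+-identityʳ (2 ^ k))) (applyUpTo-cong (upper c (2 ^ k)) (2 ^ k))) ⟩
  applyUpTo (c * 2 * 2 ^ k +_) (2 ^ k) ++ applyUpTo ((1 + c * 2) * 2 ^ k +_) (2 ^ k)
    ≡⟨ sym (cong₂ _++_ (map-upTo _ (2 ^ k)) (map-upTo _ (2 ^ k))) ⟩
  intervalElems k (c * 2) ++ intervalElems k (1 + c * 2) ∎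
  where
  open ≡-Reasoning
  lower : ∀ c n j → c * (2 * n) + j ≡ c * 2 * n + j
  lower = solve-∀
  upper : ∀ c n j → c * (2 * n) + (n + j) ≡ (1 + c * 2) * n + j
  upper = solve-∀

inIntervalᵇ-block : ∀ k c {A B} → B < 2 ^ k → T (inIntervalᵇ k c (A * 2 ^ k + B)) ⇔ A ≡ c
inIntervalᵇ-block k c {A} {B} B< = mk⇔ to from
  where
  to : T (inIntervalᵇ k c (A * 2 ^ k + B)) → A ≡ c
  to t with Equivalence.to T-∧ t
  ... | lo , hi = ≤-antisym (≤-pred (*-cancelʳ-< (2 ^ k) A (suc c) A<)) (≤-pred (*-cancelʳ-< (2 ^ k) c (suc A) c<))
    where
    A< : A * 2 ^ k < suc c * 2 ^ k
    A< = ≤-<-trans (m≤m+n (A * 2 ^ k) B) (<ᵇ⇒< _ _ hi)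
    c< : c * 2 ^ k < suc A * 2 ^ k
    c< = ≤-<-trans (≤ᵇ⇒≤ _ _ lo) (m*o+n<p*o {A} ≤-refl B<)
  from : A ≡ c → T (inIntervalᵇ k c (A * 2 ^ k + B))
  from refl = Equivalence.from T-∧ (≤⇒≤ᵇ (m≤m+n (A * 2 ^ k) B) , <⇒<ᵇ (m*o+n<p*o {A} ≤-refl B<))

append-bit-< : ∀ q {t c} → t < 2 → c < 2 ^ q → t + c * 2 < 2 ^ suc q
append-bit-< q {t} {c} t<2 c< = subst₂ _<_ (+-comm (c * 2) t) (*-comm (2 ^ q) 2) (m*o+n<p*o c< t<2)

flipBit-order : ∀ f C {K} R .{{_ : NonZero K}} →
  (C + (flipBit f 0 * K + R) <ᵇ C + (flipBit f 1 * K + R)) ≡ not f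
flipBit-order false C {K} R = det (<ᵇ-reflects-< _ _) (ofʸ (+-monoʳ-< C (+-monoˡ-< R (*-monoˡ-< K {0} {1} z<s))))
flipBit-order true  C {K} R = det (<ᵇ-reflects-< _ _) (ofⁿ (<⇒≯ (+-monoʳ-< C (+-monoˡ-< R (*-monoˡ-< K {0} {1} z<s)))))

module _ (f : Bool) (π : List ℕ) (p k : ℕ) (rev-π : BitReversal f (p + k) π) where

  at-block : ∀ {h l} → h < 2 ^ k → l < 2 ^ p →
    at π (h * 2 ^ p + l) ≡ reverseBits f p l * 2 ^ k + reverseBits f k h
  at-block {h} {l} h< l< = trans (rev-π (subst (h * 2 ^ p + l <_) 2^k*2^p≡2^[p+k] (m*o+n<p*o h< l<)))
                                 (reverseBits-split f p k h l<)
    where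
    2^k*2^p≡2^[p+k] : 2 ^ k * 2 ^ p ≡ 2 ^ (p + k)
    2^k*2^p≡2^[p+k] = trans (*-comm (2 ^ k) (2 ^ p)) (sym (^-distribˡ-+-* 2 p k))

  filter-block : ∀ {h c} → h < 2 ^ k → c < 2 ^ p →
    filterᵇ (λ i → inIntervalᵇ k c (at π i)) (intervalElems p h) ≡ h * 2 ^ p + reverseBits f p c ∷ []
  filter-block {h} {c} h< c< =
    trans (cong (filterᵇ _) (map-upTo (h * 2 ^ p +_) (2 ^ p)))
          (filterᵇ-applyUpTo-single _ _ (reverseBits-< f p c)
            (Equivalence.from (lands-in-T (reverseBits-< f p c)) (reverseBits-involutive f p c<))
            (λ j< hit → trans (sym (reverseBits-involutive f p j<))
                              (cong (reverseBits f p) (Equivalence.to (lands-in-T j<) hit))))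
    where
    lands-in-T : ∀ {j} → j < 2 ^ p → T (inIntervalᵇ k c (at π (h * 2 ^ p + j))) ⇔ reverseBits f p j ≡ c
    lands-in-T j< rewrite at-block h< j< = inIntervalᵇ-block k c (reverseBits-< f k h)

φ-pair : ∀ π k₁ c₁ k₂ c₂ {a b} →
  filterᵇ (λ i → inIntervalᵇ k₂ c₂ (at π i)) (intervalElems k₁ c₁) ≡ a ∷ b ∷ [] →
  φ π (k₁ , c₁) (k₂ , c₂) ≡ just (if at π a <ᵇ at π b then e else s)
φ-pair π k₁ c₁ k₂ c₂ hits rewrite hits = refl

φ-bitReversal : ∀ f r q {π c₁ c₂} → BitReversal f (r + suc q) π → c₁ < 2 ^ q → c₂ < 2 ^ r →
  φ π (suc r , c₁) (suc q , c₂) ≡ just (if not f then e else s)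
φ-bitReversal f r q {π} {c₁} {c₂} rev-π c₁< c₂< =
  trans (φ-pair π (suc r) c₁ (suc q) c₂ hits)
  (cong (λ b → just (if b then e else s))
       (trans (cong₂ _<ᵇ_ (value z<s) (value (s<s z<s)))
              (flipBit-order f (c₂ * 2 ^ suc q) (reverseBits f q c₁) {{m^n≢0 2 q}})))
  where
  l₀ = reverseBits f r c₂
  P = λ i → inIntervalᵇ (suc q) c₂ (at π i)
  hits : filterᵇ P (intervalElems (suc r) c₁) ≡ c₁ * 2 * 2 ^ r + l₀ ∷ (1 + c₁ * 2) * 2 ^ r + l₀ ∷ []
  hits = begin
    filterᵇ P (intervalElems (suc r) c₁)
      ≡⟨ cong (filterᵇ P) (intervalElems-suc r c₁) ⟩
    filterᵇ P (intervalElems r (c₁ * 2) ++ intervalElems r (1 + c₁ * 2))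
      ≡⟨ filter-++ (T? ∘ P) (intervalElems r (c₁ * 2)) _ ⟩
    filterᵇ P (intervalElems r (c₁ * 2)) ++ filterᵇ P (intervalElems r (1 + c₁ * 2))
      ≡⟨ cong₂ _++_ (filter-block f π r (suc q) rev-π (append-bit-< q z<s c₁<) c₂<)
                    (filter-block f π r (suc q) rev-π (append-bit-< q (s<s z<s) c₁<) c₂<) ⟩
    c₁ * 2 * 2 ^ r + l₀ ∷ (1 + c₁ * 2) * 2 ^ r + l₀ ∷ [] ∎
    where open ≡-Reasoning
  value : ∀ {t} → t < 2 →
    at π ((t + c₁ * 2) * 2 ^ r + l₀) ≡ c₂ * 2 ^ suc q + (flipBit f t * 2 ^ q + reverseBits f q c₁)
  value t<2 = trans (at-block f π r (suc q) rev-π (append-bit-< q t<2 c₁<) (reverseBits-< f r c₂))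
                    (cong₂ (λ c b → c * 2 ^ suc q + b) (reverseBits-involutive f r c₂<) (reverseBits-bit f q c₁ t<2))

lemma2p17 : (m : ℕ) → 1 ≤ m →
    (S T : ℕ × ℕ) → IsComplementaryPair m S T →
    (φ (x m) S T ≡ just e) × (φ (y m) S T ≡ just s)
lemma2p17 .(r + suc q) _ (suc r , c₁) (suc q , c₂) ((_ , c₁<) , (_ , c₂<) , _ , _ , refl) =
  φ-bitReversal false r q (at-x (r + suc q)) c₁<′ c₂<′ ,
  φ-bitReversal true  r q (at-y (r + suc q)) c₁<′ c₂<′
  where
  c₁<′ : c₁ < 2 ^ q
  c₁<′ = subst (λ n → c₁ < 2 ^ n) (trans (cong (_∸ suc r) (+-suc r q)) (m+n∸m≡n (suc r) q)) c₁<
  c₂<′ : c₂ < 2 ^ r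
  c₂<′ = subst (λ n → c₂ < 2 ^ n) (m+n∸n≡m r (suc q)) c₂<
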